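{- Let $(E,f)$ be a polymatroid, let $U\subseteq E$ and $X,Y\subseteq E\setminus U$. Let $(E\cup Z,g)$ be a common information extension of $(E,f)$ for the pair $(X\cup U,\,Y\cup U)$. Then the polymatroid $((E\cup Z)\setminus U,\,(g|U))$ is a common information extension of the polymatroid $(E\setminus U,\,(f|U))$ for the pair $(X,Y)$.
   Context: A polymatroid is a pair $(E,f)$ with $E$ finite and $f:\mathcal P(E)\to\mathbb R$ monotone, submodular, $f(\emptyset)=0$. Notation: $f(X\mid Z)=f(X\cup Z)-f(Z)$, $f(X:Y\mid Z)=f(X\cup Z)+f(Y\cup Z)-f(X\cup Y\cup Z)-f(Z)$. For $U\subseteq E$, the contraction $(E\setminus U,(f|U))$ is the polymatroid with $(f|U)(X)=f(X\mid U)$ for $X\subseteq E\setminus U$. A polymatroid $(E\cup Z,g)$ with $E\cap Z=\emptyset$ is an extension of $(E,f)$ if $g(X)=f(X)$ for all $X\subseteq E$. For $X,Y$ in the ground set, $Z$ is a common information for $(X,Y)$ in a polymatroid $g$ if $g(Z\mid X)=g(Z\mid Y)=0$ and $g(X:Y\mid Z)=0$; a common information (CI) extension of $(E,f)$ for $(X,Y)$ is an extension $(E\cup Z,g)$ in which $Z$ is a common information for $(X,Y)$. -}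

module Defs where

open import Level using (Level; _⊔_) renaming (suc to lsuc)
open import Data.Nat using (ℕ)
open import Data.Fin.Subset using (Subset; ⊥; _∪_; _∩_; _⊆_; Empty)
open import Algebra.Bundles using (AbelianGroup)
open import Relation.Binary.Core using (Rel)
open import Relation.Binary.Structures using (IsTotalOrder)
open import Data.Product using (_×_)

-- Agda's stdlib has no reals,
-- so we work over an arbitrary totally ordered abelian group (the additive
-- ordered group of ℝ is an instance); only +, -, 0 and ≤ are ever used.
record OrderedAbelianGroup (c ℓ₁ ℓ₂ : Level) : Set (lsuc (c ⊔ ℓ₁ ⊔ ℓ₂)) where
  field
    abelianGroup : AbelianGroup c ℓ₁
  open AbelianGroup abelianGroup public
  field
    _≤_          : Rel Carrier ℓ₂
    isTotalOrder : IsTotalOrder _≈_ _≤_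
    ∙-monoˡ-≤    : ∀ {x y} z → x ≤ y → (x ∙ z) ≤ (y ∙ z)

module Polymatroids {c ℓ₁ ℓ₂ : Level} (G : OrderedAbelianGroup c ℓ₁ ℓ₂) where
  open OrderedAbelianGroup G

  _+ᴳ_ : Carrier → Carrier → Carrier
  x +ᴳ y = x ∙ y

  _-ᴳ_ : Carrier → Carrier → Carrier
  x -ᴳ y = x ∙ (y ⁻¹)

  0ᴳ : Carrier
  0ᴳ = ε

  -- All ground sets live inside a common universe Fin n and are given as
  -- subsets  S : Subset n.  A set function is a map  Subset n → Carrier;
  -- only its values on subsets of the ground set S matter.
  record IsPolymatroid {n : ℕ} (S : Subset n) (f : Subset n → Carrier)
         : Set (c ⊔ ℓ₁ ⊔ ℓ₂) where
    field
      f-⊥       : f ⊥ ≈ 0ᴳ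
      monotone  : ∀ A B → A ⊆ S → B ⊆ S → A ⊆ B → f A ≤ f B
      submodular : ∀ A B → A ⊆ S → B ⊆ S →
                   (f (A ∪ B) +ᴳ f (A ∩ B)) ≤ (f A +ᴳ f B)

  cond : {n : ℕ} → (Subset n → Carrier) → Subset n → Subset n → Carrier
  cond f X Z = f (X ∪ Z) -ᴳ f Z

  mutualInfo : {n : ℕ} → (Subset n → Carrier) → Subset n → Subset n → Subset n → Carrier
  mutualInfo f X Y Z = ((f (X ∪ Z) +ᴳ f (Y ∪ Z)) -ᴳ f ((X ∪ Y) ∪ Z)) -ᴳ f Z

  contract : {n : ℕ} → (Subset n → Carrier) → Subset n → Subset n → Carrier
  contract f U X = cond f X U

  record IsExtension {n : ℕ} (E : Subset n) (f : Subset n → Carrier)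
         (Z : Subset n) (g : Subset n → Carrier) : Set (c ⊔ ℓ₁ ⊔ ℓ₂) where
    field
      disjoint    : Empty (E ∩ Z)
      polymatroid : IsPolymatroid (E ∪ Z) g
      agrees      : ∀ A → A ⊆ E → g A ≈ f A

  IsCommonInfo : {n : ℕ} → (Subset n → Carrier) → Subset n → Subset n → Subset n → Set ℓ₁
  IsCommonInfo g X Y Z = (cond g Z X ≈ 0ᴳ) × (cond g Z Y ≈ 0ᴳ) × (mutualInfo g X Y Z ≈ 0ᴳ)

  IsCIExtension : {n : ℕ} → Subset n → (Subset n → Carrier) → Subset n → Subset n →
                  Subset n → (Subset n → Carrier) → Set (c ⊔ ℓ₁ ⊔ ℓ₂)
  IsCIExtension E f X Y Z g = IsExtension E f Z g × IsCommonInfo g X Y Z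

{-# OPTIONS --safe #-}
-- Write A = X ∪ U and B = Y ∪ U.  Submodularity on A ∪ Z and B ∪ Z, together with
-- g(A : B | Z) = 0, forces g((A ∪ Z) ∩ (B ∪ Z)) ≤ g(Z); since Z ∪ U lies in that intersection,
-- monotonicity gives g(Z ∪ U) = g(Z).  Contracting U shifts every value by the constant g(U),
-- which conditional quantities do not see, so in g|U the conditions on Z become
-- g(Z | X ∪ U) = g(Z | Y ∪ U) = 0 and g(X : Y | Z ∪ U) = g(X ∪ U : Y ∪ U | Z) = 0.
module Submission where

open import Defs
open import Level using (Level)
open import Data.Nat using (ℕ)
open import Data.Fin.Subset using (Subset; _∪_; _∩_; _─_; _⊆_)
open import Data.Fin.Subset.Properties
  using ( ⊆-trans; p⊆p∪q; q⊆p∪q; p∩q⊆p; p─q⊆p; x∈p∪q⁻; x∈p∩q⁺; x∈p∩q⁻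
        ; ∪-assoc; ∪-identityˡ; ∪-distribʳ-∩; ∪-idempotentCommutativeMonoid )
open import Data.Product using (_,_)
open import Data.Sum using ([_,_])
open import Relation.Binary.PropositionalEquality using (_≡_; refl; cong)
open import Relation.Binary.Bundles using (TotalOrder)
import Algebra.Properties.AbelianGroup as AbelianGroupProperties
import Algebra.Properties.CommutativeSemigroup as CommutativeSemigroupProperties
import Algebra.Solver.IdempotentCommutativeMonoid as ∪-Solver
import Relation.Binary.Reasoning.PartialOrder as PosetReasoning

module _ {n : ℕ} where
  open ∪-Solver (∪-idempotentCommutativeMonoid n) using (solve; _⊜_; _⊕_)

  ∪-lub : {p q r : Subset n} → p ⊆ r → q ⊆ r → p ∪ q ⊆ r
  ∪-lub {p} {q} p⊆r q⊆r x∈p∪q = [ p⊆r , q⊆r ] (x∈p∪q⁻ p q x∈p∪q)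

  ∪-monoˡ-⊆ : {p q : Subset n} (r : Subset n) → p ⊆ q → p ∪ r ⊆ q ∪ r
  ∪-monoˡ-⊆ r p⊆q = ∪-lub (⊆-trans p⊆q (p⊆p∪q r)) (q⊆p∪q _ r)

  ∩-monoˡ-⊆ : {p q : Subset n} (r : Subset n) → p ⊆ q → p ∩ r ⊆ q ∩ r
  ∩-monoˡ-⊆ {p} r p⊆q x∈p∩r with x∈p∩q⁻ p r x∈p∩r
  ... | x∈p , x∈r = x∈p∩q⁺ (p⊆q x∈p , x∈r)

  ∪-distribʳ-∪ : (p q r : Subset n) → (p ∪ q) ∪ r ≡ (p ∪ r) ∪ (q ∪ r)
  ∪-distribʳ-∪ = solve 3 (λ p q r → (p ⊕ q) ⊕ r ⊜ (p ⊕ r) ⊕ (q ⊕ r)) refl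

  ∪-shuffle : (p q r : Subset n) → p ∪ (q ∪ r) ≡ (p ∪ r) ∪ q
  ∪-shuffle = solve 3 (λ p q r → p ⊕ (q ⊕ r) ⊜ (p ⊕ r) ⊕ q) refl

  ∪-∪-shuffle : (p q r s : Subset n) → (p ∪ q) ∪ (r ∪ s) ≡ ((p ∪ s) ∪ (q ∪ s)) ∪ r
  ∪-∪-shuffle = solve 4 (λ p q r s → (p ⊕ q) ⊕ (r ⊕ s) ⊜ ((p ⊕ s) ⊕ (q ⊕ s)) ⊕ r) refl

module PolymatroidContraction {c ℓ₁ ℓ₂ : Level} (G : OrderedAbelianGroup c ℓ₁ ℓ₂) where
  open OrderedAbelianGroup G
  open Polymatroids G
  open AbelianGroupProperties abelianGroup
    using (⁻¹-anti-homo‿-; x∙y⁻¹≈ε⇒x≈y; \\-leftDividesʳ; //-rightDividesˡ; //-rightDividesʳ)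
  open CommutativeSemigroupProperties commutativeSemigroup using (interchange; xy∙z≈xz∙y)

  totalOrder : TotalOrder c ℓ₁ ℓ₂
  totalOrder = record { isTotalOrder = isTotalOrder }

  open PosetReasoning (TotalOrder.poset totalOrder)
  open TotalOrder totalOrder using (antisym)

  -‿translate : ∀ p q u → (p - u) - (q - u) ≈ p - q
  -‿translate p q u = begin-equality
    (p - u) - (q - u)          ≈⟨ ∙-congˡ (⁻¹-anti-homo‿- q u) ⟩
    (p ∙ u ⁻¹) ∙ (u ∙ q ⁻¹)    ≈⟨ assoc p (u ⁻¹) (u ∙ q ⁻¹) ⟩
    p ∙ (u ⁻¹ ∙ (u ∙ q ⁻¹))    ≈⟨ ∙-congˡ (\\-leftDividesʳ u (q ⁻¹)) ⟩
    p - q                      ∎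

  mutualInfo-translate : ∀ a b t w u →
    (((a - u) ∙ (b - u)) - (t - u)) - (w - u) ≈ ((a ∙ b) - t) - w
  mutualInfo-translate a b t w u = begin-equality
    (((a - u) ∙ (b - u)) - (t - u)) - (w - u)  ≈⟨ ∙-congʳ (∙-congʳ (assoc (a - u) b (u ⁻¹))) ⟨
    ((((a - u) ∙ b) - u) - (t - u)) - (w - u)  ≈⟨ ∙-congʳ (-‿translate ((a - u) ∙ b) t u) ⟩
    (((a - u) ∙ b) - t) - (w - u)              ≈⟨ ∙-congʳ (∙-congʳ (xy∙z≈xz∙y a (u ⁻¹) b)) ⟩
    (((a ∙ b) - u) - t) - (w - u)              ≈⟨ ∙-congʳ (xy∙z≈xz∙y (a ∙ b) (u ⁻¹) (t ⁻¹)) ⟩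
    (((a ∙ b) - t) - u) - (w - u)              ≈⟨ -‿translate ((a ∙ b) - t) w u ⟩
    ((a ∙ b) - t) - w                          ∎

  [x-y]-z≈ε⇒x≈y∙z : ∀ x y z → (x - y) - z ≈ ε → x ≈ y ∙ z
  [x-y]-z≈ε⇒x≈y∙z x y z x-y-z≈ε = begin-equality
    x              ≈⟨ //-rightDividesˡ y x ⟨
    (x - y) ∙ y    ≈⟨ ∙-congʳ (x∙y⁻¹≈ε⇒x≈y (x - y) z x-y-z≈ε) ⟩
    z ∙ y          ≈⟨ comm z y ⟩
    y ∙ z          ∎

  ∙-cancelˡ-≤ : ∀ z {x y} → (z ∙ x) ≤ (z ∙ y) → x ≤ y
  ∙-cancelˡ-≤ z {x} {y} zx≤zy = begin
    x            ≈⟨ //-rightDividesʳ z x ⟨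
    (x ∙ z) - z  ≈⟨ ∙-congʳ (comm x z) ⟩
    (z ∙ x) - z  ≤⟨ ∙-monoˡ-≤ (z ⁻¹) zx≤zy ⟩
    (z ∙ y) - z  ≈⟨ ∙-congʳ (comm z y) ⟩
    (y ∙ z) - z  ≈⟨ //-rightDividesʳ z y ⟩
    y            ∎

  module _ {n : ℕ} (g : Subset n → Carrier) where

    g-cong : {A B : Subset n} → A ≡ B → g A ≈ g B
    g-cong A≡B = reflexive (cong g A≡B)

    cond-contract : ∀ A B U → cond (contract g U) A B ≈ cond g A (B ∪ U)
    cond-contract A B U = begin-equality
      (g ((A ∪ B) ∪ U) - g U) - (g (B ∪ U) - g U)  ≈⟨ -‿translate (g ((A ∪ B) ∪ U)) (g (B ∪ U)) (g U) ⟩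
      g ((A ∪ B) ∪ U) - g (B ∪ U)                  ≈⟨ ∙-congʳ (g-cong (∪-assoc A B U)) ⟩
      g (A ∪ (B ∪ U)) - g (B ∪ U)                  ∎

    mutualInfo-contract : ∀ X Y Z U → mutualInfo (contract g U) X Y Z ≈ mutualInfo g X Y (Z ∪ U)
    mutualInfo-contract X Y Z U = begin-equality
      mutualInfo (contract g U) X Y Z
        ≈⟨ mutualInfo-translate (g ((X ∪ Z) ∪ U)) (g ((Y ∪ Z) ∪ U)) (g (((X ∪ Y) ∪ Z) ∪ U)) (g (Z ∪ U)) (g U) ⟩
      ((g ((X ∪ Z) ∪ U) ∙ g ((Y ∪ Z) ∪ U)) - g (((X ∪ Y) ∪ Z) ∪ U)) - g (Z ∪ U)
        ≈⟨ ∙-congʳ (∙-cong (∙-cong (g-cong (∪-assoc X Z U)) (g-cong (∪-assoc Y Z U)))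
                           (⁻¹-cong (g-cong (∪-assoc (X ∪ Y) Z U)))) ⟩
      mutualInfo g X Y (Z ∪ U) ∎

    mutualInfo-absorb : ∀ X Y Z U → g (Z ∪ U) ≈ g Z →
      mutualInfo g X Y (Z ∪ U) ≈ mutualInfo g (X ∪ U) (Y ∪ U) Z
    mutualInfo-absorb X Y Z U g[Z∪U]≈g[Z] =
      ∙-cong (∙-cong (∙-cong (g-cong (∪-shuffle X Z U)) (g-cong (∪-shuffle Y Z U)))
                     (⁻¹-cong (g-cong (∪-∪-shuffle X Y Z U))))
             (⁻¹-cong g[Z∪U]≈g[Z])

  module _ {n : ℕ} {S : Subset n} {g : Subset n → Carrier} (g-pm : IsPolymatroid S g) where
    open IsPolymatroid g-pm

    contract-isPolymatroid : ∀ {T U} → T ⊆ S → U ⊆ S → IsPolymatroid T (contract g U)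
    contract-isPolymatroid {T} {U} T⊆S U⊆S = record
      { f-⊥        = trans (∙-congʳ (g-cong g (∪-identityˡ U))) (inverseʳ (g U))
      ; monotone   = λ A B A⊆T B⊆T A⊆B →
          ∙-monoˡ-≤ (g U ⁻¹) (monotone (A ∪ U) (B ∪ U) (∪U⊆S A⊆T) (∪U⊆S B⊆T) (∪-monoˡ-⊆ U A⊆B))
      ; submodular = contract-submodular
      }
      where
      ∪U⊆S : ∀ {A} → A ⊆ T → A ∪ U ⊆ S
      ∪U⊆S A⊆T = ∪-lub (⊆-trans A⊆T T⊆S) U⊆S

      contract-submodular : ∀ A B → A ⊆ T → B ⊆ T →
        (contract g U (A ∪ B) ∙ contract g U (A ∩ B)) ≤ (contract g U A ∙ contract g U B)
      contract-submodular A B A⊆T B⊆T = begin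
        (g ((A ∪ B) ∪ U) - g U) ∙ (g ((A ∩ B) ∪ U) - g U)
          ≈⟨ interchange _ _ _ _ ⟩
        (g ((A ∪ B) ∪ U) ∙ g ((A ∩ B) ∪ U)) ∙ (g U ⁻¹ ∙ g U ⁻¹)
          ≈⟨ ∙-congʳ (∙-cong (g-cong g (∪-distribʳ-∪ A B U)) (g-cong g (∪-distribʳ-∩ U A B))) ⟩
        (g ((A ∪ U) ∪ (B ∪ U)) ∙ g ((A ∪ U) ∩ (B ∪ U))) ∙ (g U ⁻¹ ∙ g U ⁻¹)
          ≤⟨ ∙-monoˡ-≤ _ (submodular (A ∪ U) (B ∪ U) (∪U⊆S A⊆T) (∪U⊆S B⊆T)) ⟩
        (g (A ∪ U) ∙ g (B ∪ U)) ∙ (g U ⁻¹ ∙ g U ⁻¹)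
          ≈⟨ interchange _ _ _ _ ⟨
        (g (A ∪ U) - g U) ∙ (g (B ∪ U) - g U) ∎

    mutualInfo≈ε⇒g[Z∪U]≈g[Z] : ∀ {A B Z U} → A ∪ Z ⊆ S → B ∪ Z ⊆ S → U ⊆ A → U ⊆ B →
      mutualInfo g A B Z ≈ ε → g (Z ∪ U) ≈ g Z
    mutualInfo≈ε⇒g[Z∪U]≈g[Z] {A} {B} {Z} {U} P⊆S Q⊆S U⊆A U⊆B A⊥B∣Z =
      antisym (begin g (Z ∪ U) ≤⟨ g[Z∪U]≤g[P∩Q] ⟩ g (P ∩ Q) ≤⟨ g[P∩Q]≤g[Z] ⟩ g Z ∎)
              (monotone Z (Z ∪ U) Z⊆S Z∪U⊆S (p⊆p∪q U))
      where
      P Q : Subset n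
      P = A ∪ Z
      Q = B ∪ Z

      Z⊆S : Z ⊆ S
      Z⊆S = ⊆-trans (q⊆p∪q A Z) P⊆S

      Z∪U⊆S : Z ∪ U ⊆ S
      Z∪U⊆S = ∪-lub Z⊆S (⊆-trans (⊆-trans U⊆A (p⊆p∪q Z)) P⊆S)

      g[Z∪U]≤g[P∩Q] : g (Z ∪ U) ≤ g (P ∩ Q)
      g[Z∪U]≤g[P∩Q] = monotone (Z ∪ U) (P ∩ Q) Z∪U⊆S (⊆-trans (p∩q⊆p P Q) P⊆S)
        (∪-lub (λ x∈Z → x∈p∩q⁺ (q⊆p∪q A Z x∈Z , q⊆p∪q B Z x∈Z))
               (λ x∈U → x∈p∩q⁺ (p⊆p∪q Z (U⊆A x∈U) , p⊆p∪q Z (U⊆B x∈U))))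

      g[P∩Q]≤g[Z] : g (P ∩ Q) ≤ g Z
      g[P∩Q]≤g[Z] = ∙-cancelˡ-≤ (g (P ∪ Q)) (begin
        g (P ∪ Q) ∙ g (P ∩ Q)  ≤⟨ submodular P Q P⊆S Q⊆S ⟩
        g P ∙ g Q              ≈⟨ [x-y]-z≈ε⇒x≈y∙z (g P ∙ g Q) (g ((A ∪ B) ∪ Z)) (g Z) A⊥B∣Z ⟩
        g ((A ∪ B) ∪ Z) ∙ g Z  ≈⟨ ∙-congʳ (g-cong g (∪-distribʳ-∪ A B Z)) ⟩
        g (P ∪ Q) ∙ g Z        ∎)

  contract-isExtension : ∀ {n} {E Z U : Subset n} {f g : Subset n → Carrier} →
    IsExtension E f Z g → U ⊆ E → IsExtension (E ─ U) (contract f U) Z (contract g U)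
  contract-isExtension {E = E} {Z} {U} ext U⊆E = record
    { disjoint    = λ { (x , x∈E─U∩Z) → disjoint (x , ∩-monoˡ-⊆ Z E─U⊆E x∈E─U∩Z) }
    ; polymatroid = contract-isPolymatroid polymatroid (∪-monoˡ-⊆ Z E─U⊆E) (⊆-trans U⊆E (p⊆p∪q Z))
    ; agrees      = λ A A⊆E─U → ∙-cong (agrees (A ∪ U) (∪-lub (⊆-trans A⊆E─U E─U⊆E) U⊆E))
                                       (⁻¹-cong (agrees U U⊆E))
    }
    where
    open IsExtension ext

    E─U⊆E : E ─ U ⊆ E
    E─U⊆E = p─q⊆p E U

open PolymatroidContraction

mainTheorem3 : ∀ {c ℓ₁ ℓ₂ : Level} (G : OrderedAbelianGroup c ℓ₁ ℓ₂) →
    ∀ {n : ℕ} (E U X Y Z : Subset n) (f g : Subset n → OrderedAbelianGroup.Carrier G) →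
    Polymatroids.IsPolymatroid G E f →
    U ⊆ E → X ⊆ (E ─ U) → Y ⊆ (E ─ U) →
    Polymatroids.IsCIExtension G E f (X ∪ U) (Y ∪ U) Z g →
    Polymatroids.IsCIExtension G (E ─ U) (Polymatroids.contract G f U) X Y Z (Polymatroids.contract G g U)
mainTheorem3 G E U X Y Z f g _ U⊆E X⊆E─U Y⊆E─U (ext , Z∣X∪U , Z∣Y∪U , X∪U⊥Y∪U∣Z) =
  contract-isExtension G ext U⊆E ,
  trans (cond-contract G g Z X U) Z∣X∪U ,
  trans (cond-contract G g Z Y U) Z∣Y∪U ,
  trans (mutualInfo-contract G g X Y Z U)
        (trans (mutualInfo-absorb G g X Y Z U g[Z∪U]≈g[Z]) X∪U⊥Y∪U∣Z)
  where
  open OrderedAbelianGroup G using (_≈_; trans)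
  open Polymatroids.IsExtension ext using (polymatroid)

  ∪Z⊆E∪Z : ∀ {V} → V ⊆ E ─ U → (V ∪ U) ∪ Z ⊆ E ∪ Z
  ∪Z⊆E∪Z V⊆E─U = ∪-monoˡ-⊆ Z (∪-lub (⊆-trans V⊆E─U (p─q⊆p E U)) U⊆E)

  g[Z∪U]≈g[Z] : g (Z ∪ U) ≈ g Z
  g[Z∪U]≈g[Z] = mutualInfo≈ε⇒g[Z∪U]≈g[Z] G polymatroid
    (∪Z⊆E∪Z X⊆E─U) (∪Z⊆E∪Z Y⊆E─U) (q⊆p∪q X U) (q⊆p∪q Y U) X∪U⊥Y∪U∣Z
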